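{- Let $n\ge1$. In the wiggly lattice, each wiggly permutation $\sigma$ covers exactly as many wiggly permutations as $\sigma$ has descents, and is covered by exactly as many wiggly permutations as $\sigma$ has ascents. Consequently, the (undirected) cover graph of the wiggly lattice is regular of degree $2n-1$ and connected.
   Context: A wiggly permutation is a permutation of $[2n]$ avoiding the patterns $(2j-1)\cdots i\cdots(2j)$ for $j\in[n]$, $i<2j-1$, and $(2j)\cdots k\cdots(2j-1)$ for $j\in[n]$, $k>2j$. The weak order on permutations of $[2n]$ is inclusion of inversion sets $\mathrm{inv}(\sigma)=\{(\sigma(p),\sigma(q)) : p<q,\ \sigma(p)>\sigma(q)\}$; the wiggly lattice is the subposet of the weak order induced by wiggly permutations (a sublattice). An ascent (resp. descent) of $\sigma$ is a position $p\in[2n-1]$ with $\sigma(p)<\sigma(p+1)$ (resp. $\sigma(p)>\sigma(p+1)$). -}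

module Defs where

open import Data.Nat using (ℕ; zero; suc; _+_; _*_; _∸_; _<_; _≤_; _<ᵇ_)
open import Data.Bool using (if_then_else_)
open import Data.List using (List; []; _∷_; _++_; applyUpTo; length)
open import Data.List.Relation.Binary.Permutation.Propositional using (_↭_)
open import Data.List.Relation.Unary.Unique.Propositional using (Unique)
open import Data.List.Membership.Propositional using (_∈_)
open import Data.Product using (_×_; ∃; ∃-syntax; Σ-syntax)
open import Data.Sum using (_⊎_)
open import Relation.Nullary using (¬_)
open import Relation.Binary.PropositionalEquality using (_≡_; _≢_)
open import Relation.Binary.Construct.Closure.ReflexiveTransitive using (Star)
open import Function.Bundles using (_⇔_)

-- A permutation of [m] = {1,…,m} is represented in one-line notation
-- as the list σ(1) σ(2) … σ(m).
Perm : ℕ → List ℕ → Set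
Perm m σ = σ ↭ applyUpTo suc m

Before : List ℕ → ℕ → ℕ → Set
Before σ a b = ∃[ xs ] ∃[ ys ] ∃[ zs ] σ ≡ xs ++ a ∷ ys ++ b ∷ zs

Before3 : List ℕ → ℕ → ℕ → ℕ → Set
Before3 σ a b c =
  ∃[ xs ] ∃[ ys ] ∃[ zs ] ∃[ ws ] σ ≡ xs ++ a ∷ ys ++ b ∷ zs ++ c ∷ ws

Pattern1 : ℕ → List ℕ → Set
Pattern1 n σ = ∃[ j ] ∃[ i ] (1 ≤ j × j ≤ n × i < 2 * j ∸ 1 × Before3 σ (2 * j ∸ 1) i (2 * j))

Pattern2 : ℕ → List ℕ → Set
Pattern2 n σ = ∃[ j ] ∃[ k ] (1 ≤ j × j ≤ n × 2 * j < k × Before3 σ (2 * j) k (2 * j ∸ 1))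

Wiggly : ℕ → List ℕ → Set
Wiggly n σ = Perm (2 * n) σ × ¬ Pattern1 n σ × ¬ Pattern2 n σ

Inv : List ℕ → ℕ → ℕ → Set
Inv σ a b = Before σ a b × b < a

_≤W_ : List ℕ → List ℕ → Set
τ ≤W σ = ∀ a b → Inv τ a b → Inv σ a b

_<W_ : List ℕ → List ℕ → Set
τ <W σ = τ ≤W σ × τ ≢ σ

Covers : ℕ → List ℕ → List ℕ → Set
Covers n σ τ = Wiggly n σ × Wiggly n τ × τ <W σ ×
  (¬ (∃[ ρ ] (Wiggly n ρ × τ <W ρ × ρ <W σ)))

Adj : ℕ → List ℕ → List ℕ → Set
Adj n σ τ = Covers n σ τ ⊎ Covers n τ σ

descents : List ℕ → ℕ
descents (x ∷ y ∷ r) = (if y <ᵇ x then 1 else 0) + descents (y ∷ r)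
descents _ = 0

ascents : List ℕ → ℕ
ascents (x ∷ y ∷ r) = (if x <ᵇ y then 1 else 0) + ascents (y ∷ r)
ascents _ = 0

HasCard : (List ℕ → Set) → ℕ → Set
HasCard P k = ∃[ L ] (Unique L × (∀ τ → (τ ∈ L) ⇔ P τ) × length L ≡ k)

-- Let (a, b) be a descent of a wiggly permutation σ = P a b S. Grow a block B rightwards from b,
-- absorbing the next entry as long as B contains some 2j whose partner 2j − 1 still lies to its
-- right, and symmetrically a block A leftwards from a, absorbing while A contains some 2j whose
-- partner lies to its left. Every entry of B is smaller than every entry of A, and exchanging the
-- blocks yields a wiggly permutation τ below σ; the minimality of B is what keeps τ wiggly, and
-- every wiggly ρ ≤ σ in which a does not precede b is forced below τ, so σ covers τ. Conversely a
-- wiggly ρ < σ cannot keep the order of every adjacent pair of σ (it would then keep all pairs and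
-- equal σ), so it un-inverts some descent and lies below the corresponding τ. Hence the lower covers
-- of σ correspond to its descents. The complement x ↦ 2n + 1 − x swaps the two forbidden patterns
-- and reverses the weak order, turning lower covers into upper covers and descents into ascents;
-- descents and ascents together number 2n − 1. Every cover step lowers the inversion number, so
-- descending along covers from any wiggly permutation reaches the identity.

module Submission where

open import Data.Bool using (true; false; T; if_then_else_)
open import Data.Empty using (⊥-elim)
open import Data.List using (List; []; _∷_; _++_; [_]; length; map; reverse; applyUpTo; filter)
open import Data.List.Membership.Propositional using (_∈_; _∉_; find; lose)
open import Data.List.Membership.Propositional.Properties
  using (∈-++⁺ˡ; ∈-++⁺ʳ; ∈-++⁻; ∈-insert; ∈-∃++; ∈-applyUpTo⁻; ∈-map⁺; ∈-map⁻; ∈-filter⁺)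
open import Data.List.Properties
  using (length-map; length-++; length-applyUpTo; ++-assoc; ++-identityʳ; ++-cancelˡ; ∷-injective; ∷-injectiveˡ;
         ∷-injectiveʳ; unfold-reverse; reverse-++; reverse-involutive; ≡-dec; applyUpTo-∷ʳ; map-∘; map-id-local;
         map-applyUpTo; filter-++; filter-none)
open import Data.List.Relation.Binary.Permutation.Propositional
  using (_↭_; ↭-refl; ↭-sym; ↭-trans; ↭-reflexive; ↭⇒↭ₛ)
open import Data.List.Relation.Binary.Permutation.Propositional.Properties
  using (∈-resp-↭; shifts; drop-∷; ++⁺ˡ; map⁺; ↭-reverse; ↭-length)
open import Data.List.Relation.Unary.All using (All; []; _∷_)
import Data.List.Relation.Unary.All as All
import Data.List.Relation.Unary.All.Properties as All
open import Data.List.Relation.Unary.AllPairs as AllPairs using (AllPairs; []; _∷_)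
import Data.List.Relation.Unary.AllPairs.Properties as AllPairs
open import Data.List.Relation.Unary.Any using (Any; here; there; any?; satisfied)
open import Data.List.Relation.Unary.Any.Properties using (reverse⁺; reverse⁻)
open import Data.List.Relation.Unary.Linked using (Linked; []; [-]; _∷_)
open import Data.List.Relation.Unary.Linked.Properties using (Linked⇒AllPairs)
open import Data.List.Relation.Unary.Unique.Propositional using (Unique)
open import Data.List.Relation.Unary.Unique.Propositional.Properties using (applyUpTo⁺₁)
  renaming (Unique[x∷xs]⇒x∉xs to head∉tail)
import Data.List.Relation.Unary.Unique.Propositional.Properties as Unique
open import Data.Nat using (ℕ; _≟_; zero; suc; _+_; _*_; _∸_; _<_; _≤_; _<ᵇ_; z≤n; s≤s)
open import Data.Nat.Induction using (<-wellFounded)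
open import Data.Nat.Properties
open import Data.Nat.Tactic.RingSolver using (solve-∀)
open import Data.Product using (_×_; _,_; ∃-syntax; proj₁; proj₂)
open import Data.Sum using (_⊎_; inj₁; inj₂)
import Data.Sum as Sum
open import Function using (_∘_)
open import Function.Bundles using (mk⇔; Equivalence)
open import Induction.WellFounded using (Acc; acc)
open import Relation.Binary.Construct.Closure.ReflexiveTransitive using (Star; ε; _◅_; _◅◅_)
import Relation.Binary.Construct.Closure.ReflexiveTransitive as Star
open import Relation.Binary.Definitions using (Transitive; tri<; tri≈; tri>)
open import Relation.Binary.PropositionalEquality hiding ([_])
open import Relation.Nullary using (¬_; Dec; yes; no; ofʸ; ofⁿ)
open import Relation.Nullary.Decidable using (map′)

open import Data.List.Membership.DecPropositional _≟_ using (_∈?_)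
open import Data.List.Relation.Binary.Permutation.Setoid.Properties (setoid ℕ) using (Unique-resp-↭)

open import Defs

private
  variable
    C : Set
    x y z : C
    xs ys zs : List C
    R : C → C → Set

data Precedes {C : Set} : List C → C → C → Set where
  first : y ∈ xs → Precedes (x ∷ xs) x y
  later : Precedes xs x y → Precedes (z ∷ xs) x y

Precedes⇒∈ˡ : Precedes xs x y → x ∈ xs
Precedes⇒∈ˡ (first _) = here refl
Precedes⇒∈ˡ (later p) = there (Precedes⇒∈ˡ p)

Precedes⇒∈ʳ : Precedes xs x y → y ∈ xs
Precedes⇒∈ʳ (first y∈xs) = there y∈xs
Precedes⇒∈ʳ (later p) = there (Precedes⇒∈ʳ p)

Precedes-irrefl : Unique xs → Precedes xs x y → x ≢ y
Precedes-irrefl u (first y∈xs) refl = head∉tail u y∈xs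
Precedes-irrefl (_ ∷ u) (later p) = Precedes-irrefl u p

Precedes-asym : Unique xs → Precedes xs x y → ¬ Precedes xs y x
Precedes-asym u (first y∈xs) (first x∈xs) = head∉tail u x∈xs
Precedes-asym u (first _) (later q) = head∉tail u (Precedes⇒∈ʳ q)
Precedes-asym u (later p) (first _) = head∉tail u (Precedes⇒∈ʳ p)
Precedes-asym (_ ∷ u) (later p) (later q) = Precedes-asym u p q

Precedes-trans : Unique xs → Transitive (Precedes xs)
Precedes-trans u (first y∈xs) (first _) = ⊥-elim (head∉tail u y∈xs)
Precedes-trans u (first _) (later q) = first (Precedes⇒∈ʳ q)
Precedes-trans u (later p) (first _) = ⊥-elim (head∉tail u (Precedes⇒∈ʳ p))
Precedes-trans (_ ∷ u) (later p) (later q) = later (Precedes-trans u p q)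

Precedes-total : x ∈ xs → y ∈ xs → x ≢ y → Precedes xs x y ⊎ Precedes xs y x
Precedes-total (here refl) (here refl) x≢y = ⊥-elim (x≢y refl)
Precedes-total (here refl) (there y∈xs) _ = inj₁ (first y∈xs)
Precedes-total (there x∈xs) (here refl) _ = inj₂ (first x∈xs)
Precedes-total (there x∈xs) (there y∈xs) x≢y with Precedes-total x∈xs y∈xs x≢y
... | inj₁ p = inj₁ (later p)
... | inj₂ p = inj₂ (later p)

Precedes-flip : Unique xs → x ∈ xs → y ∈ xs → x ≢ y → ¬ Precedes xs x y → Precedes xs y x
Precedes-flip _ x∈xs y∈xs x≢y ¬p with Precedes-total x∈xs y∈xs x≢y
... | inj₁ p = ⊥-elim (¬p p)
... | inj₂ p = p

Precedes-++⁺ˡ : Precedes xs x y → Precedes (xs ++ ys) x y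
Precedes-++⁺ˡ (first y∈xs) = first (∈-++⁺ˡ y∈xs)
Precedes-++⁺ˡ (later p) = later (Precedes-++⁺ˡ p)

Precedes-++⁺ʳ : ∀ xs → Precedes ys x y → Precedes (xs ++ ys) x y
Precedes-++⁺ʳ [] p = p
Precedes-++⁺ʳ (_ ∷ xs) p = later (Precedes-++⁺ʳ xs p)

Precedes-++⁺ : x ∈ xs → y ∈ ys → Precedes (xs ++ ys) x y
Precedes-++⁺ {xs = _ ∷ xs} (here refl) y∈ys = first (∈-++⁺ʳ xs y∈ys)
Precedes-++⁺ (there x∈xs) y∈ys = later (Precedes-++⁺ x∈xs y∈ys)

Precedes-++⁻ : ∀ xs → Precedes (xs ++ ys) x y →
               Precedes xs x y ⊎ Precedes ys x y ⊎ (x ∈ xs × y ∈ ys)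
Precedes-++⁻ [] p = inj₂ (inj₁ p)
Precedes-++⁻ (_ ∷ xs) (first y∈xs++ys) with ∈-++⁻ xs y∈xs++ys
... | inj₁ y∈xs = inj₁ (first y∈xs)
... | inj₂ y∈ys = inj₂ (inj₂ (here refl , y∈ys))
Precedes-++⁻ (_ ∷ xs) (later p) with Precedes-++⁻ xs p
... | inj₁ q = inj₁ (later q)
... | inj₂ (inj₁ q) = inj₂ (inj₁ q)
... | inj₂ (inj₂ (x∈xs , y∈ys)) = inj₂ (inj₂ (there x∈xs , y∈ys))

AllPairs-Precedes : AllPairs R xs → Precedes xs x y → R x y
AllPairs-Precedes (Rx ∷ _) (first y∈xs) = All.lookup Rx y∈xs
AllPairs-Precedes (_ ∷ Rxs) (later p) = AllPairs-Precedes Rxs p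

Precedes-reverse⁺ : Precedes xs x y → Precedes (reverse xs) y x
Precedes-reverse⁺ {xs = x ∷ xs} (first y∈xs) =
  subst (λ l → Precedes l _ x) (sym (unfold-reverse x xs)) (Precedes-++⁺ (reverse⁺ y∈xs) (here refl))
Precedes-reverse⁺ {xs = z ∷ xs} (later p) =
  subst (λ l → Precedes l _ _) (sym (unfold-reverse z xs)) (Precedes-++⁺ˡ (Precedes-reverse⁺ p))

Precedes-swap : ∀ W X Y {Z} → Precedes (W ++ Y ++ X ++ Z) x y →
                Precedes (W ++ X ++ Y ++ Z) x y ⊎ (x ∈ Y × y ∈ X)
Precedes-swap W X Y {Z} p with Precedes-++⁻ W p
... | inj₁ q = inj₁ (Precedes-++⁺ˡ q)
... | inj₂ (inj₂ (x∈W , y∈YXZ)) = inj₁ (Precedes-++⁺ x∈W (∈-resp-↭ (shifts Y X) y∈YXZ))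
... | inj₂ (inj₁ q) with Precedes-++⁻ Y q
...   | inj₁ r = inj₁ (Precedes-++⁺ʳ W (Precedes-++⁺ʳ X (Precedes-++⁺ˡ r)))
...   | inj₂ (inj₂ (x∈Y , y∈XZ)) with ∈-++⁻ X y∈XZ
...     | inj₁ y∈X = inj₂ (x∈Y , y∈X)
...     | inj₂ y∈Z = inj₁ (Precedes-++⁺ʳ W (Precedes-++⁺ʳ X (Precedes-++⁺ x∈Y y∈Z)))
Precedes-swap W X Y {Z} p | inj₂ (inj₁ q) | inj₂ (inj₁ r) with Precedes-++⁻ X r
...   | inj₁ t = inj₁ (Precedes-++⁺ʳ W (Precedes-++⁺ˡ t))
...   | inj₂ (inj₁ t) = inj₁ (Precedes-++⁺ʳ W (Precedes-++⁺ʳ X (Precedes-++⁺ʳ Y t)))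
...   | inj₂ (inj₂ (x∈X , y∈Z)) = inj₁ (Precedes-++⁺ʳ W (Precedes-++⁺ x∈X (∈-++⁺ʳ Y y∈Z)))

Precedes-adjacent : ∀ p {s} → Precedes (p ++ x ∷ y ∷ s) x y
Precedes-adjacent p = Precedes-++⁺ʳ p (first (here refl))

adjacent-nothing-between : ∀ p {s} → Unique (p ++ x ∷ y ∷ s) →
                           Precedes (p ++ x ∷ y ∷ s) x z → ¬ Precedes (p ++ x ∷ y ∷ s) z y
adjacent-nothing-between [] u (first (here refl)) q = Precedes-irrefl u q refl
adjacent-nothing-between [] u (first (there z∈s)) (first _) = head∉tail u (there z∈s)
adjacent-nothing-between [] (_ ∷ u) (first (there y∈s)) (later (first _)) = head∉tail u y∈s
adjacent-nothing-between [] (_ ∷ u) (first (there _)) (later (later q)) = head∉tail u (Precedes⇒∈ʳ q)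
adjacent-nothing-between [] u (later p) _ = head∉tail u (Precedes⇒∈ˡ p)
adjacent-nothing-between (_ ∷ p) u (first _) _ = head∉tail u (∈-insert p)
adjacent-nothing-between (_ ∷ p) u (later r) (first _) = head∉tail u (Precedes⇒∈ʳ r)
adjacent-nothing-between (_ ∷ p) (_ ∷ u) (later r) (later q) = adjacent-nothing-between p u r q

adjacent-successor-unique : ∀ p p′ {y′ s s′} → Unique (p ++ x ∷ y ∷ s) →
                            p ++ x ∷ y ∷ s ≡ p′ ++ x ∷ y′ ∷ s′ → y ≡ y′
adjacent-successor-unique [] [] _ eq = ∷-injectiveˡ (∷-injectiveʳ eq)
adjacent-successor-unique [] (_ ∷ p′) u eq with refl ← ∷-injectiveˡ eq =
  ⊥-elim (head∉tail u (subst (_ ∈_) (sym (∷-injectiveʳ eq)) (∈-insert p′)))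
adjacent-successor-unique (_ ∷ p) [] u eq with refl ← ∷-injectiveˡ eq = ⊥-elim (head∉tail u (∈-insert p))
adjacent-successor-unique (_ ∷ p) (_ ∷ p′) (_ ∷ u) eq = adjacent-successor-unique p p′ u (∷-injectiveʳ eq)

linked-or : ∀ {E : Set} xs → (∀ p {x y s} → xs ≡ p ++ x ∷ y ∷ s → R x y ⊎ E) → Linked R xs ⊎ E
linked-or [] _ = inj₁ []
linked-or (x ∷ []) _ = inj₁ [-]
linked-or (x ∷ y ∷ xs) decide
  with decide [] refl | linked-or (y ∷ xs) (λ p eq → decide (x ∷ p) (cong (x ∷_) eq))
... | inj₂ e | _ = inj₂ e
... | inj₁ _ | inj₂ e = inj₂ e
... | inj₁ r | inj₁ rs = inj₁ (r ∷ rs)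

prefix-to-head : ∀ xs {u : C} {ys z zs} → xs ++ u ∷ ys ≡ z ∷ zs → ∃[ M ] xs ++ [ u ] ≡ z ∷ M
prefix-to-head [] eq = [] , cong [_] (∷-injectiveˡ eq)
prefix-to-head (_ ∷ xs) {u} eq = xs ++ [ u ] , cong (_∷ xs ++ [ u ]) (∷-injectiveˡ eq)

proper-prefix : ∀ xs {u y : C} {ys zs} → xs ++ [ u ] ≢ (xs ++ u ∷ y ∷ ys) ++ zs
proper-prefix [] ()
proper-prefix (_ ∷ xs) eq = proper-prefix xs (∷-injectiveʳ eq)

Precedes-map⁺ : ∀ {D : Set} (f : C → D) → Precedes xs x y → Precedes (map f xs) (f x) (f y)
Precedes-map⁺ f (first y∈xs) = first (∈-map⁺ f y∈xs)
Precedes-map⁺ f (later p) = later (Precedes-map⁺ f p)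

Precedes-map⁻ : ∀ {D : Set} {f : C → D} xs {u v} → Precedes (map f xs) u v →
                ∃[ x ] ∃[ y ] (f x ≡ u × f y ≡ v × Precedes xs x y)
Precedes-map⁻ {f = f} (x ∷ xs) (first v∈) with y , y∈xs , refl ← ∈-map⁻ f v∈ =
  x , y , refl , refl , first y∈xs
Precedes-map⁻ (_ ∷ xs) (later p) with x , y , refl , refl , q ← Precedes-map⁻ xs p =
  x , y , refl , refl , later q

map⁺-injectiveOn : ∀ {D : Set} {f : C → D} → (∀ {x y} → x ∈ xs → y ∈ xs → f x ≡ f y → x ≡ y) →
                   Unique xs → Unique (map f xs)
map⁺-injectiveOn {xs = []} _ [] = []
map⁺-injectiveOn {xs = _ ∷ _} inj (x≢ ∷ u) =
  All.map⁺ (All.tabulate λ y∈ fx≡fy → All.lookup x≢ y∈ (inj (here refl) (there y∈) fx≡fy)) ∷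
  map⁺-injectiveOn (λ x∈ y∈ → inj (there x∈) (there y∈)) u

Precedes-preserving⇒≡ : {σ τ : List ℕ} → Unique σ → Unique τ → σ ↭ τ →
                        (∀ {x y} → Precedes σ x y → Precedes τ x y) → σ ≡ τ
Precedes-preserving⇒≡ {[]} {[]} _ _ _ _ = refl
Precedes-preserving⇒≡ {[]} {_ ∷ _} _ _ σ↭τ _ with () ← ∈-resp-↭ (↭-sym σ↭τ) (here refl)
Precedes-preserving⇒≡ {_ ∷ _} {[]} _ _ σ↭τ _ with () ← ∈-resp-↭ σ↭τ (here refl)
Precedes-preserving⇒≡ {x ∷ σ} {y ∷ τ} uσ uτ σ↭τ pres with x ≟ y
... | yes refl = cong (x ∷_) (Precedes-preserving⇒≡ (AllPairs.tail uσ) (AllPairs.tail uτ) (drop-∷ σ↭τ) pres′)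
  where
  pres′ : ∀ {u v} → Precedes σ u v → Precedes τ u v
  pres′ p with pres (later p)
  ... | first _ = ⊥-elim (head∉tail uσ (Precedes⇒∈ˡ p))
  ... | later q = q
... | no x≢y with ∈-resp-↭ (↭-sym σ↭τ) (here refl)
...   | here y≡x = ⊥-elim (x≢y (sym y≡x))
...   | there y∈σ with pres (first y∈σ)
...     | first _ = ⊥-elim (x≢y refl)
...     | later q = ⊥-elim (head∉tail uτ (Precedes⇒∈ʳ q))

-- Growing a block

module Grow {C : Set} (Open : List C → List C → Set) (open? : ∀ K R → Dec (Open K R)) where

  grow : List C → List C → List C × List C
  grow K [] = K , []
  grow K (h ∷ R) with open? K (h ∷ R)
  ... | yes _ = grow (K ++ [ h ]) R
  ... | no _ = K , h ∷ R

  grown rest : List C → List C → List C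
  grown K R = proj₁ (grow K R)
  rest K R = proj₂ (grow K R)

  grown++rest : ∀ K R → grown K R ++ rest K R ≡ K ++ R
  grown++rest K [] = refl
  grown++rest K (h ∷ R) with open? K (h ∷ R)
  ... | yes _ = trans (grown++rest (K ++ [ h ]) R) (++-assoc K [ h ] R)
  ... | no _ = refl

  grown-extends : ∀ K R → ∃[ M ] grown K R ≡ K ++ M
  grown-extends K [] = [] , sym (++-identityʳ K)
  grown-extends K (h ∷ R) with open? K (h ∷ R)
  ... | no _ = [] , sym (++-identityʳ K)
  ... | yes _ with grown-extends (K ++ [ h ]) R
  ...   | M , eq = h ∷ M , trans eq (++-assoc K [ h ] M)

  grown-closed : (∀ K → ¬ Open K []) → ∀ K R → ¬ Open (grown K R) (rest K R)
  grown-closed closed-[] K [] = closed-[] K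
  grown-closed closed-[] K (h ∷ R) with open? K (h ∷ R)
  ... | yes _ = grown-closed closed-[] (K ++ [ h ]) R
  ... | no ¬open = ¬open

  grown-preserves : (Q : C → Set) → ∀ K R →
    (∀ {K′ h R′} → K′ ++ h ∷ R′ ≡ K ++ R → Open K′ (h ∷ R′) → All Q K′ → Q h) →
    All Q K → All Q (grown K R)
  grown-preserves Q K R step = go K R refl
    where
    go : ∀ K′ R′ → K′ ++ R′ ≡ K ++ R → All Q K′ → All Q (grown K′ R′)
    go K′ [] _ q = q
    go K′ (h ∷ R′) eq q with open? K′ (h ∷ R′)
    ... | yes o = go (K′ ++ [ h ]) R′ (trans (++-assoc K′ [ h ] R′) eq) (All.++⁺ q (step eq o q ∷ []))
    ... | no _ = q

  grown-minimal : ∀ K R M {R₀} → K ++ R ≡ (K ++ M) ++ R₀ → ¬ Open (K ++ M) R₀ →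
                  ∃[ M′ ] K ++ M ≡ grown K R ++ M′
  grown-minimal K [] M _ _ = M , refl
  grown-minimal K (h ∷ R) M eq ¬open with open? K (h ∷ R)
  ... | no _ = M , refl
  grown-minimal K (h ∷ R) [] {R₀} eq ¬open | yes o =
    ⊥-elim (¬open (subst₂ Open (sym (++-identityʳ K)) h∷R≡R₀ o))
    where
    h∷R≡R₀ : h ∷ R ≡ R₀
    h∷R≡R₀ = ++-cancelˡ K (h ∷ R) R₀ (trans eq (cong (_++ R₀) (++-identityʳ K)))
  grown-minimal K (h ∷ R) (h′ ∷ M) {R₀} eq ¬open | yes o
    with ∷-injective (++-cancelˡ K (h ∷ R) _ (trans eq (++-assoc K (h′ ∷ M) R₀)))
  ... | refl , refl
    with M′ , eq′ ← grown-minimal (K ++ [ h ]) (M ++ R₀) M (sym (++-assoc (K ++ [ h ]) M R₀))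
                      (¬open ∘ subst (λ K₀ → Open K₀ R₀) (++-assoc K [ h ] M))
    = M′ , trans (sym (++-assoc K [ h ] M)) eq′

Before⇒Precedes : ∀ {σ x y} → Before σ x y → Precedes σ x y
Before⇒Precedes (xs , ys , _ , refl) = Precedes-++⁺ʳ xs (first (∈-insert ys))

Precedes⇒Before : ∀ {σ x y} → Precedes σ x y → Before σ x y
Precedes⇒Before (first y∈σ) with ys , zs , refl ← ∈-∃++ y∈σ = [] , ys , zs , refl
Precedes⇒Before (later p) with xs , ys , zs , refl ← Precedes⇒Before p = _ ∷ xs , ys , zs , refl

Before3⇒Precedes : ∀ {σ x y z} → Before3 σ x y z → Precedes σ x y × Precedes σ y z
Before3⇒Precedes (xs , ys , zs , _ , refl) =
  Precedes-++⁺ʳ xs (first (∈-insert ys)) , Precedes-++⁺ʳ xs (later (Precedes-++⁺ʳ ys (first (∈-insert zs))))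

Precedes⇒Before3 : ∀ {σ x y z} → Unique σ → Precedes σ x y → Precedes σ y z → Before3 σ x y z
Precedes⇒Before3 u (first _) (later q) with ys , zs , ws , refl ← Precedes⇒Before q = [] , ys , zs , ws , refl
Precedes⇒Before3 (_ ∷ u) (later p) (later q) with xs , ys , zs , ws , refl ← Precedes⇒Before3 u p q =
  _ ∷ xs , ys , zs , ws , refl
Precedes⇒Before3 u (first y∈σ) (first _) = ⊥-elim (head∉tail u y∈σ)
Precedes⇒Before3 u (later p) (first _) = ⊥-elim (head∉tail u (Precedes⇒∈ʳ p))

module _ {m : ℕ} {σ : List ℕ} where

  Perm⇒Unique : Perm m σ → Unique σ
  Perm⇒Unique p = Unique-resp-↭ (↭⇒↭ₛ (↭-sym p)) (applyUpTo⁺₁ suc m (λ i<j _ → <⇒≢ i<j ∘ suc-injective))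

  Perm-∈⇒bounds : ∀ {x} → Perm m σ → x ∈ σ → 1 ≤ x × x ≤ m
  Perm-∈⇒bounds p x∈σ with i , i<m , refl ← ∈-applyUpTo⁻ suc (∈-resp-↭ p x∈σ) = s≤s z≤n , i<m

  module _ {τ : List ℕ} where

    Perm⇒↭ : Perm m σ → Perm m τ → σ ↭ τ
    Perm⇒↭ pσ pτ = ↭-trans pσ (↭-sym pτ)

    Perm-∈ : ∀ {x} → Perm m σ → Perm m τ → x ∈ σ → x ∈ τ
    Perm-∈ pσ pτ = ∈-resp-↭ (Perm⇒↭ pσ pτ)

1≤2j∸1⇒1≤j : ∀ {j} → 1 ≤ 2 * j ∸ 1 → 1 ≤ j
1≤2j∸1⇒1≤j {suc _} _ = s≤s z≤n

-- Unlike Pattern1 and Pattern2 these omit the bounds 1 ≤ j ≤ n, which hold automatically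
-- for the entries of a permutation of [2n].
Avoids₁ Avoids₂ : List ℕ → Set
Avoids₁ σ = ∀ j i → Precedes σ (2 * j ∸ 1) i → Precedes σ i (2 * j) → ¬ i < 2 * j ∸ 1
Avoids₂ σ = ∀ j k → Precedes σ (2 * j) k → Precedes σ k (2 * j ∸ 1) → ¬ 2 * j < k

module _ {n : ℕ} {σ : List ℕ} where

  private
    j≤n : ∀ {j} → 2 * j ≤ 2 * n → j ≤ n
    j≤n = *-cancelˡ-≤ 2

  Wiggly⇒Unique : Wiggly n σ → Unique σ
  Wiggly⇒Unique (p , _) = Perm⇒Unique p

  Wiggly⇒Avoids₁ : Wiggly n σ → Avoids₁ σ
  Wiggly⇒Avoids₁ (p , ¬pattern₁ , _) j i p₁ p₂ i<2j-1 = ¬pattern₁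
    (j , i , 1≤2j∸1⇒1≤j (proj₁ (Perm-∈⇒bounds p (Precedes⇒∈ˡ p₁))) , j≤n (proj₂ (Perm-∈⇒bounds p (Precedes⇒∈ʳ p₂))) ,
     i<2j-1 , Precedes⇒Before3 (Perm⇒Unique p) p₁ p₂)

  Wiggly⇒Avoids₂ : Wiggly n σ → Avoids₂ σ
  Wiggly⇒Avoids₂ (p , _ , ¬pattern₂) j k p₁ p₂ 2j<k = ¬pattern₂
    (j , k , 1≤2j∸1⇒1≤j (proj₁ (Perm-∈⇒bounds p (Precedes⇒∈ʳ p₂))) , j≤n (proj₂ (Perm-∈⇒bounds p (Precedes⇒∈ˡ p₁))) ,
     2j<k , Precedes⇒Before3 (Perm⇒Unique p) p₁ p₂)

  Avoids⇒Wiggly : Perm (2 * n) σ → Avoids₁ σ → Avoids₂ σ → Wiggly n σ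
  Avoids⇒Wiggly p avoids₁ avoids₂ = p ,
    (λ (j , i , _ , _ , i<2j-1 , b) → let p₁ , p₂ = Before3⇒Precedes b in avoids₁ j i p₁ p₂ i<2j-1) ,
    (λ (j , k , _ , _ , 2j<k , b) → let p₁ , p₂ = Before3⇒Precedes b in avoids₂ j k p₁ p₂ 2j<k)

_⊑_ : List ℕ → List ℕ → Set
τ ⊑ σ = ∀ {x y} → Precedes τ x y → y < x → Precedes σ x y

module _ {σ τ : List ℕ} where

  ≤W⇒⊑ : τ ≤W σ → τ ⊑ σ
  ≤W⇒⊑ τ≤σ p y<x = Before⇒Precedes (proj₁ (τ≤σ _ _ (Precedes⇒Before p , y<x)))

  ⊑⇒≤W : τ ⊑ σ → τ ≤W σ
  ⊑⇒≤W τ⊑σ _ _ (b , y<x) = Precedes⇒Before (τ⊑σ (Before⇒Precedes b) y<x) , y<x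

  kept-or-lost : ∀ {x y} → Unique σ → Unique τ → τ ⊑ σ → x ∈ τ → y ∈ τ → Precedes σ x y →
                 Precedes τ x y ⊎ (y < x × ¬ Precedes τ x y)
  kept-or-lost {x} {y} uσ uτ τ⊑σ x∈τ y∈τ xy with Precedes-total x∈τ y∈τ (Precedes-irrefl uσ xy)
  ... | inj₁ kept = inj₁ kept
  ... | inj₂ yx with <-cmp x y
  ...   | tri< x<y _ _ = ⊥-elim (Precedes-asym uσ xy (τ⊑σ yx x<y))
  ...   | tri≈ _ x≡y _ = ⊥-elim (Precedes-irrefl uσ xy x≡y)
  ...   | tri> _ _ y<x = inj₂ (y<x , Precedes-asym uτ yx)

⊑-keeps-ascent : ∀ {m σ τ u v} → Perm m σ → Perm m τ → τ ⊑ σ → Precedes σ u v → u < v → Precedes τ u v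
⊑-keeps-ascent pσ pτ τ⊑σ p u<v =
  Precedes-flip (Perm⇒Unique pτ) (Perm-∈ pσ pτ (Precedes⇒∈ʳ p)) (Perm-∈ pσ pτ (Precedes⇒∈ˡ p)) (<⇒≢ u<v ∘ sym)
    (λ q → Precedes-asym (Perm⇒Unique pσ) p (τ⊑σ q u<v))

record Descent (σ : List ℕ) : Set where
  constructor descent
  field
    prefix : List ℕ
    top bottom : ℕ
    suffix : List ℕ
    split : σ ≡ prefix ++ top ∷ bottom ∷ suffix
    bottom<top : bottom < top

open Descent public

Descent-Precedes : ∀ {σ} (d : Descent σ) → Precedes σ (top d) (bottom d)
Descent-Precedes d = subst (λ σ → Precedes σ _ _) (sym (split d)) (Precedes-adjacent (prefix d))

UninvertedDescent : List ℕ → List ℕ → Set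
UninvertedDescent σ τ = ∃[ d ] ¬ Precedes τ (top {σ} d) (bottom d)

module _ {m : ℕ} {σ τ : List ℕ} (pσ : Perm m σ) (pτ : Perm m τ) where

  ⊑⇒≡⊎UninvertedDescent : τ ⊑ σ → τ ≡ σ ⊎ UninvertedDescent σ τ
  ⊑⇒≡⊎UninvertedDescent τ⊑σ with linked-or σ adjacent-kept-or-lost
    where
    adjacent-kept-or-lost : ∀ p {x y s} → σ ≡ p ++ x ∷ y ∷ s → Precedes τ x y ⊎ UninvertedDescent σ τ
    adjacent-kept-or-lost p {x} {y} {s} eq
      with xy ← subst (λ σ → Precedes σ x y) (sym eq) (Precedes-adjacent p)
      with kept-or-lost (Perm⇒Unique pσ) (Perm⇒Unique pτ) τ⊑σ
             (Perm-∈ pσ pτ (Precedes⇒∈ˡ xy)) (Perm-∈ pσ pτ (Precedes⇒∈ʳ xy)) xy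
    ... | inj₁ kept = inj₁ kept
    ... | inj₂ (y<x , lost) = inj₂ (descent p x y s eq y<x , lost)
  ... | inj₂ uninverted = inj₂ uninverted
  ... | inj₁ linked = inj₁ (sym (Precedes-preserving⇒≡ (Perm⇒Unique pσ) (Perm⇒Unique pτ) (Perm⇒↭ pσ pτ)
                              (AllPairs-Precedes (Linked⇒AllPairs (Precedes-trans (Perm⇒Unique pτ)) linked))))

  ⊑-antisym : τ ⊑ σ → σ ⊑ τ → τ ≡ σ
  ⊑-antisym τ⊑σ σ⊑τ with ⊑⇒≡⊎UninvertedDescent τ⊑σ
  ... | inj₁ τ≡σ = τ≡σ
  ... | inj₂ (d , lost) = ⊥-elim (lost (σ⊑τ (Descent-Precedes d) (bottom<top d)))

  <W⇒UninvertedDescent : τ <W σ → UninvertedDescent σ τ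
  <W⇒UninvertedDescent (τ≤σ , τ≢σ) with ⊑⇒≡⊎UninvertedDescent (≤W⇒⊑ τ≤σ)
  ... | inj₁ τ≡σ = ⊥-elim (τ≢σ τ≡σ)
  ... | inj₂ uninverted = uninverted

Descent-∷ : ∀ x {σ} → Descent σ → Descent (x ∷ σ)
Descent-∷ x d = descent (x ∷ prefix d) (top d) (bottom d) (suffix d) (cong (x ∷_) (split d)) (bottom<top d)

top-∈ : ∀ {σ} (d : Descent σ) → top d ∈ σ
top-∈ d = Precedes⇒∈ˡ (Descent-Precedes d)

headDescent : ∀ x y σ b → (T b → y < x) → List (Descent (x ∷ y ∷ σ))
headDescent x y σ true y<x = descent [] x y σ refl (y<x _) ∷ []
headDescent x y σ false _ = []

descentList : (σ : List ℕ) → List (Descent σ)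
descentList [] = []
descentList (_ ∷ []) = []
descentList (x ∷ y ∷ σ) = headDescent x y σ (y <ᵇ x) (<ᵇ⇒< y x) ++ map (Descent-∷ x) (descentList (y ∷ σ))

length-descentList : ∀ σ → length (descentList σ) ≡ descents σ
length-descentList [] = refl
length-descentList (_ ∷ []) = refl
length-descentList (x ∷ y ∷ σ) = begin
  length (hd ++ tl)      ≡⟨ length-++ hd ⟩
  length hd + length tl  ≡⟨ cong₂ _+_ (length-headDescent (y <ᵇ x) (<ᵇ⇒< y x))
                                      (trans (length-map (Descent-∷ x) (descentList (y ∷ σ)))
                                             (length-descentList (y ∷ σ))) ⟩
  descents (x ∷ y ∷ σ)   ∎
  where
  open ≡-Reasoning
  hd = headDescent x y σ (y <ᵇ x) (<ᵇ⇒< y x)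
  tl = map (Descent-∷ x) (descentList (y ∷ σ))
  length-headDescent : ∀ b f → length (headDescent x y σ b f) ≡ (if b then 1 else 0)
  length-headDescent true _ = refl
  length-headDescent false _ = refl

Descent-∷-∈ : ∀ x {σ} {d : Descent σ} → d ∈ descentList σ → Descent-∷ x d ∈ descentList (x ∷ σ)
Descent-∷-∈ x {y ∷ σ} d∈ = ∈-++⁺ʳ (headDescent x y σ _ _) (∈-map⁺ (Descent-∷ x) d∈)

descentList-complete : ∀ {σ} (d : Descent σ) →
                       ∃[ d′ ] (d′ ∈ descentList σ × top d′ ≡ top d × bottom d′ ≡ bottom d)
descentList-complete (descent [] x y σ refl y<x) with y <ᵇ x | <ᵇ⇒< y x | <⇒<ᵇ y<x
... | true | _ | _ = _ , here refl , refl , refl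
descentList-complete (descent (x ∷ p) a b s refl a<b)
  with d′ , d′∈ , top≡ , bottom≡ ← descentList-complete (descent p a b s refl a<b)
  = Descent-∷ x d′ , Descent-∷-∈ x d′∈ , top≡ , bottom≡

descentList-tops-distinct : ∀ {σ} → Unique σ → AllPairs (λ d d′ → top d ≢ top d′) (descentList σ)
descentList-tops-distinct {[]} _ = []
descentList-tops-distinct {_ ∷ []} _ = []
descentList-tops-distinct {x ∷ y ∷ σ} (x∉ ∷ u) =
  with-head (y <ᵇ x) (<ᵇ⇒< y x) x≢tops (AllPairs.map⁺ (descentList-tops-distinct u))
  where
  x≢tops : All (λ d → x ≢ top d) (map (Descent-∷ x) (descentList (y ∷ σ)))
  x≢tops = All.map⁺ (All.tabulate λ {d} _ x≡ → head∉tail (x∉ ∷ u) (subst (_∈ _) (sym x≡) (top-∈ d)))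
  with-head : ∀ b f {ds} → All (λ d → x ≢ top d) ds → AllPairs (λ d d′ → top d ≢ top d′) ds →
              AllPairs (λ d d′ → top d ≢ top d′) (headDescent x y σ b f ++ ds)
  with-head true _ x≢ ds-distinct = x≢ ∷ ds-distinct
  with-head false _ _ ds-distinct = ds-distinct

below : ℕ → List ℕ → ℕ
below x ys = length (filter (_<? x) ys)

inversions : List ℕ → ℕ
inversions [] = 0
inversions (x ∷ xs) = below x xs + inversions xs

crossings : List ℕ → List ℕ → ℕ
crossings [] ys = 0
crossings (x ∷ xs) ys = below x ys + crossings xs ys

below-++ : ∀ x ys zs → below x (ys ++ zs) ≡ below x ys + below x zs
below-++ x ys zs = trans (cong length (filter-++ (_<? x) ys zs)) (length-++ (filter (_<? x) ys))

inversions-++ : ∀ xs ys → inversions (xs ++ ys) ≡ inversions xs + inversions ys + crossings xs ys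
inversions-++ [] ys = sym (+-identityʳ (inversions ys))
inversions-++ (x ∷ xs) ys
  rewrite below-++ x xs ys | inversions-++ xs ys
  = rearrange (below x xs) (below x ys) (inversions xs) (inversions ys) (crossings xs ys)
  where
  rearrange : ∀ a b c d e → (a + b) + (c + d + e) ≡ (a + c) + d + (b + e)
  rearrange = solve-∀

crossings-++ʳ : ∀ xs ys zs → crossings xs (ys ++ zs) ≡ crossings xs ys + crossings xs zs
crossings-++ʳ [] ys zs = refl
crossings-++ʳ (x ∷ xs) ys zs
  rewrite below-++ x ys zs | crossings-++ʳ xs ys zs
  = rearrange (below x ys) (below x zs) (crossings xs ys) (crossings xs zs)
  where
  rearrange : ∀ a b c d → (a + b) + (c + d) ≡ (a + c) + (b + d)
  rearrange = solve-∀

inversions-swap : ∀ W X Y Z → inversions (W ++ Y ++ X ++ Z) + crossings X Y ≡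
                              inversions (W ++ X ++ Y ++ Z) + crossings Y X
inversions-swap W X Y Z
  rewrite inversions-++ W (Y ++ X ++ Z) | inversions-++ W (X ++ Y ++ Z)
        | inversions-++ Y (X ++ Z) | inversions-++ X (Y ++ Z) | inversions-++ X Z | inversions-++ Y Z
        | crossings-++ʳ W Y (X ++ Z) | crossings-++ʳ W X (Y ++ Z) | crossings-++ʳ W X Z | crossings-++ʳ W Y Z
        | crossings-++ʳ Y X Z | crossings-++ʳ X Y Z
  = rearrange (inversions W) (inversions X) (inversions Y) (inversions Z) (crossings X Y) (crossings Y X)
              (crossings X Z) (crossings Y Z) (crossings W X) (crossings W Y) (crossings W Z)
  where
  rearrange : ∀ iW iX iY iZ cXY cYX cXZ cYZ cWX cWY cWZ →
              iW + (iY + (iX + iZ + cXZ) + (cYX + cYZ)) + (cWY + (cWX + cWZ)) + cXY ≡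
              iW + (iX + (iY + iZ + cYZ) + (cXY + cXZ)) + (cWX + (cWY + cWZ)) + cYX
  rearrange = solve-∀

crossings-none : ∀ xs ys → All (λ x → All (x <_) ys) xs → crossings xs ys ≡ 0
crossings-none [] ys _ = refl
crossings-none (x ∷ xs) ys (x< ∷ xs<) =
  cong₂ _+_ (cong length (filter-none (_<? x) (All.map <⇒≯ x<))) (crossings-none xs ys xs<)

crossings-pos : ∀ xs ys {x y} → x ∈ xs → y ∈ ys → y < x → 0 < crossings xs ys
crossings-pos (x ∷ xs) ys (here refl) y∈ y<x =
  ≤-trans (length-pos (∈-filter⁺ (_<? x) y∈ y<x)) (m≤m+n _ _)
  where
  length-pos : ∀ {zs : List ℕ} {z} → z ∈ zs → 0 < length zs
  length-pos (here _) = s≤s z≤n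
  length-pos (there _) = s≤s z≤n
crossings-pos (x ∷ xs) ys (there x∈) y∈ y<x = ≤-trans (crossings-pos xs ys x∈ y∈ y<x) (m≤n+m _ _)

-- The lower cover attached to a descent

even-or-odd : ∀ x → (∃[ j ] x ≡ 2 * j) ⊎ (∃[ j ] x ≡ suc (2 * j))
even-or-odd zero = inj₁ (0 , refl)
even-or-odd (suc x) with even-or-odd x
... | inj₁ (j , refl) = inj₂ (j , refl)
... | inj₂ (j , refl) = inj₁ (suc j , cong suc (sym (+-suc j (j + 0))))

m∸1<n⇒m≤n : ∀ {m n} → m ∸ 1 < n → m ≤ n
m∸1<n⇒m≤n {zero} _ = z≤n
m∸1<n⇒m≤n {suc _} m≤n = m≤n

m∸1<m : ∀ {m} → 1 ≤ m → m ∸ 1 < m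
m∸1<m {suc _} _ = ≤-refl

j′<j⇒2j′<2j∸1 : ∀ {j′ j} → j′ < j → 2 * j′ < 2 * j ∸ 1
j′<j⇒2j′<2j∸1 {j′} {suc j} (s≤s j′≤j) = subst (2 * j′ <_) (sym (+-suc j (j + 0))) (s≤s (*-monoʳ-≤ 2 j′≤j))

2j′≢2j∸1 : ∀ j′ j → 1 ≤ j → 2 * j′ ≢ 2 * j ∸ 1
2j′≢2j∸1 j′ (suc j) _ eq = even≢odd j′ j (trans eq (+-suc j (j + 0)))

PartnerIn : List ℕ → ℕ → Set
PartnerIn R x = ∃[ j ] (x ≡ 2 * j × 2 * j ∸ 1 ∈ R)

SplitsPair : List ℕ → List ℕ → Set
SplitsPair K R = Any (PartnerIn R) K

splitsPair? : ∀ K R → Dec (SplitsPair K R)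
splitsPair? K R = any? partnerIn? K
  where
  partnerIn? : ∀ x → Dec (PartnerIn R x)
  partnerIn? x with even-or-odd x
  ... | inj₂ (k , x≡odd) = no λ (j , x≡even , _) → even≢odd j k (trans (sym x≡even) x≡odd)
  ... | inj₁ (j , refl) = map′ (λ m → j , refl , m)
                               (λ (j′ , eq , m) → subst (λ e → e ∸ 1 ∈ R) (sym eq) m)
                               (2 * j ∸ 1 ∈? R)

splitsPair-[] : ∀ K → ¬ SplitsPair K []
splitsPair-[] K o with satisfied o
... | _ , _ , _ , ()

open Grow SplitsPair splitsPair?

-- The prefix of σ before a is passed reversed, as L, so that A is grown leftwards from a by the
-- same procedure that grows B rightwards from b.
module Cover {n : ℕ} {σ : List ℕ} (σ-wiggly : Wiggly n σ) (L : List ℕ) (a b : ℕ) (R : List ℕ)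
             (σ≡ : σ ≡ reverse (a ∷ L) ++ b ∷ R) (b<a : b < a) where

  private
    uσ : Unique σ
    uσ = Wiggly⇒Unique σ-wiggly

    1≤ : ∀ {x} → x ∈ σ → 1 ≤ x
    1≤ x∈σ = proj₁ (Perm-∈⇒bounds (proj₁ σ-wiggly) x∈σ)

    lift : ∀ {ρ ρ′ : List ℕ} {u v} → ρ ≡ ρ′ → Precedes ρ u v → Precedes ρ′ u v
    lift refl p = p

  left⇒σ : ∀ {u v} → Precedes (a ∷ L) u v → Precedes σ v u
  left⇒σ p = lift (sym σ≡) (Precedes-++⁺ˡ (Precedes-reverse⁺ p))

  right⇒σ : ∀ {u v} → Precedes (b ∷ R) u v → Precedes σ u v
  right⇒σ p = lift (sym σ≡) (Precedes-++⁺ʳ (reverse (a ∷ L)) p)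

  left-before-right : ∀ {u v} → u ∈ a ∷ L → v ∈ b ∷ R → Precedes σ u v
  left-before-right u∈ v∈ = lift (sym σ≡) (Precedes-++⁺ (reverse⁺ u∈) v∈)

  ab : Precedes σ a b
  ab = left-before-right (here refl) (here refl)

  a∈σ : a ∈ σ
  a∈σ = Precedes⇒∈ˡ ab

  KA RA B S′ P′ A τ : List ℕ
  KA = grown [ a ] L
  RA = rest [ a ] L
  B = grown [ b ] R
  S′ = rest [ b ] R
  P′ = reverse RA
  A = reverse KA
  τ = P′ ++ B ++ A ++ S′

  σ-blocks : σ ≡ P′ ++ A ++ B ++ S′
  σ-blocks = begin
    σ                              ≡⟨ σ≡ ⟩
    reverse (a ∷ L) ++ b ∷ R       ≡⟨ cong₂ (λ l r → reverse l ++ r) (grown++rest [ a ] L) (grown++rest [ b ] R) ⟨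
    reverse (KA ++ RA) ++ B ++ S′  ≡⟨ cong (_++ B ++ S′) (reverse-++ KA RA) ⟩
    (P′ ++ A) ++ B ++ S′           ≡⟨ ++-assoc P′ A (B ++ S′) ⟩
    P′ ++ A ++ B ++ S′             ∎
    where open ≡-Reasoning

  private
    σ′ : List ℕ
    σ′ = P′ ++ A ++ B ++ S′

    inσ : ∀ {u v} → Precedes σ′ u v → Precedes σ u v
    inσ = lift (sym σ-blocks)

    outσ : ∀ {u v} → Precedes σ u v → Precedes σ′ u v
    outσ = lift σ-blocks

  P′-before-A : ∀ {u v} → u ∈ P′ → v ∈ A → Precedes σ u v
  P′-before-A u∈ v∈ = inσ (Precedes-++⁺ u∈ (∈-++⁺ˡ v∈))

  A-before-B : ∀ {u v} → u ∈ A → v ∈ B → Precedes σ u v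
  A-before-B u∈ v∈ = inσ (Precedes-++⁺ʳ P′ (Precedes-++⁺ u∈ (∈-++⁺ˡ v∈)))

  B-before-S′ : ∀ {u v} → u ∈ B → v ∈ S′ → Precedes σ u v
  B-before-S′ u∈ v∈ = inσ (Precedes-++⁺ʳ P′ (Precedes-++⁺ʳ A (Precedes-++⁺ u∈ v∈)))

  within-A : ∀ {u v} → Precedes A u v → Precedes σ u v
  within-A p = inσ (Precedes-++⁺ʳ P′ (Precedes-++⁺ˡ p))

  within-B : ∀ {u v} → Precedes B u v → Precedes σ u v
  within-B p = inσ (Precedes-++⁺ʳ P′ (Precedes-++⁺ʳ A (Precedes-++⁺ˡ p)))

  B-before-A-in-τ : ∀ {u v} → u ∈ B → v ∈ A → Precedes τ u v
  B-before-A-in-τ u∈ v∈ = Precedes-++⁺ʳ P′ (Precedes-++⁺ u∈ (∈-++⁺ˡ v∈))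

  σ⇒τ : ∀ {u v} → Precedes σ u v → Precedes τ u v ⊎ (u ∈ A × v ∈ B)
  σ⇒τ p = Precedes-swap P′ B A (outσ p)

  τ⇒σ : ∀ {u v} → Precedes τ u v → Precedes σ u v ⊎ (u ∈ B × v ∈ A)
  τ⇒σ p with Precedes-swap P′ A B p
  ... | inj₁ q = inj₁ (inσ q)
  ... | inj₂ u∈B×v∈A = inj₂ u∈B×v∈A

  block : ∀ {u} → u ∈ σ → u ∈ P′ ⊎ u ∈ A ⊎ u ∈ B ⊎ u ∈ S′
  block u∈σ with ∈-++⁻ P′ (subst (_ ∈_) σ-blocks u∈σ)
  ... | inj₁ u∈P′ = inj₁ u∈P′
  ... | inj₂ u∈ with ∈-++⁻ A u∈
  ...   | inj₁ u∈A = inj₂ (inj₁ u∈A)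
  ...   | inj₂ u∈′ with ∈-++⁻ B u∈′
  ...     | inj₁ u∈B = inj₂ (inj₂ (inj₁ u∈B))
  ...     | inj₂ u∈S′ = inj₂ (inj₂ (inj₂ u∈S′))

  B⊆σ : ∀ {u} → u ∈ B → u ∈ σ
  B⊆σ u∈B = subst (_ ∈_) (sym σ-blocks) (∈-++⁺ʳ P′ (∈-++⁺ʳ A (∈-++⁺ˡ u∈B)))

  τ-perm : Perm (2 * n) τ
  τ-perm = ↭-trans (++⁺ˡ P′ (shifts B A)) (subst (_↭ _) σ-blocks (proj₁ σ-wiggly))

  τ-unique : Unique τ
  τ-unique = Perm⇒Unique τ-perm

  private
    avoids₁ : Avoids₁ σ
    avoids₁ = Wiggly⇒Avoids₁ σ-wiggly

    avoids₂ : Avoids₂ σ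
    avoids₂ = Wiggly⇒Avoids₂ σ-wiggly

    at-or-after : ∀ (K : List ℕ) {h : ℕ} {R′ u} → u ∈ h ∷ R′ → h ≡ u ⊎ Precedes (K ++ h ∷ R′) h u
    at-or-after K (here refl) = inj₁ refl
    at-or-after K (there u∈) = inj₂ (Precedes-++⁺ʳ K (first u∈))

  B-step : ∀ {K h R′} → K ++ h ∷ R′ ≡ [ b ] ++ R → SplitsPair K (h ∷ R′) →
           ∃[ j ] (2 * j ∈ K × Precedes σ (2 * j) h × (h ≡ 2 * j ∸ 1 ⊎ Precedes σ h (2 * j ∸ 1)))
  B-step {K} eq o with _ , 2j∈K , j , refl , partner∈ ← find o =
    j , 2j∈K , right⇒σ (lift eq (Precedes-++⁺ 2j∈K (here refl))) ,
    Sum.map₂ (right⇒σ ∘ lift eq) (at-or-after K partner∈)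

  A-step : ∀ {K h L′} → K ++ h ∷ L′ ≡ [ a ] ++ L → SplitsPair K (h ∷ L′) →
           ∃[ j ] (2 * j ∈ K × Precedes σ h (2 * j) × 2 * j ∸ 1 ∈ a ∷ L ×
                   (h ≡ 2 * j ∸ 1 ⊎ Precedes σ (2 * j ∸ 1) h))
  A-step {K} eq o with _ , 2j∈K , j , refl , partner∈ ← find o =
    j , 2j∈K , left⇒σ (lift eq (Precedes-++⁺ 2j∈K (here refl))) ,
    subst (_ ∈_) eq (∈-++⁺ʳ K partner∈) , Sum.map₂ (left⇒σ ∘ lift eq) (at-or-after K partner∈)

  absorbed-below : ∀ {j h} → Precedes σ (2 * j) h → h ≡ 2 * j ∸ 1 ⊎ Precedes σ h (2 * j ∸ 1) → h < 2 * j
  absorbed-below p (inj₁ refl) = m∸1<m (1≤ (Precedes⇒∈ˡ p))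
  absorbed-below {j} {h} p (inj₂ q) = ≤∧≢⇒< (≮⇒≥ (avoids₂ j h p q)) (Precedes-irrefl uσ p ∘ sym)

  absorbed-above : ∀ {j h} → Precedes σ h (2 * j) → Precedes σ (2 * j ∸ 1) h → 2 * j < h
  absorbed-above {j} {h} p q =
    ≤∧≢⇒< (m∸1<n⇒m≤n (≤∧≢⇒< (≮⇒≥ (avoids₁ j h q p)) (Precedes-irrefl uσ q))) (Precedes-irrefl uσ p ∘ sym)

  B⊆right : ∀ {u} → u ∈ B → u ∈ b ∷ R
  B⊆right u∈B = subst (_ ∈_) (grown++rest [ b ] R) (∈-++⁺ˡ u∈B)

  B<a : All (_< a) B
  B<a = grown-preserves (_< a) [ b ] R step (b<a ∷ [])
    where
    step : ∀ {K h R′} → K ++ h ∷ R′ ≡ [ b ] ++ R → SplitsPair K (h ∷ R′) → All (_< a) K → h < a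
    step eq o K<a with j , 2j∈K , p , partner ← B-step eq o =
      <-trans (absorbed-below {j} p partner) (All.lookup K<a 2j∈K)

  above-B : ∀ {j h} → All (_< 2 * j) B → 2 * j ∸ 1 ∈ a ∷ L → Precedes σ h (2 * j) →
            h ≡ 2 * j ∸ 1 ⊎ Precedes σ (2 * j ∸ 1) h → All (_< h) B
  above-B B<2j partner∈ _ (inj₁ refl) = All.tabulate λ {y} y∈B →
    ≤∧≢⇒< (<⇒≤pred (All.lookup B<2j y∈B)) (Precedes-irrefl uσ (left-before-right partner∈ (B⊆right y∈B)) ∘ sym)
  above-B {j} B<2j _ p (inj₂ q) = All.map (λ y<2j → <-trans y<2j (absorbed-above {j} p q)) B<2j

  B<KA : All (λ x → All (_< x) B) KA
  B<KA = grown-preserves (λ x → All (_< x) B) [ a ] L step (B<a ∷ [])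
    where
    step : ∀ {K h L′} → K ++ h ∷ L′ ≡ [ a ] ++ L → SplitsPair K (h ∷ L′) →
           All (λ x → All (_< x) B) K → All (_< h) B
    step eq o B<K with j , 2j∈K , p , partner∈ , partner ← A-step eq o =
      above-B {j} (All.lookup B<K 2j∈K) partner∈ p partner

  B<A : ∀ {x y} → x ∈ A → y ∈ B → y < x
  B<A x∈A y∈B = All.lookup (All.lookup B<KA (reverse⁻ x∈A)) y∈B

  A-closed : ∀ {j} → 2 * j ∈ A → 2 * j ∸ 1 ∉ P′
  A-closed {j} 2j∈A partner∈P′ =
    grown-closed splitsPair-[] [ a ] L (lose (reverse⁻ 2j∈A) (j , refl , reverse⁻ partner∈P′))

  B-closed : ∀ {j} → 2 * j ∈ B → 2 * j ∸ 1 ∉ S′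
  B-closed {j} 2j∈B partner∈S′ = grown-closed splitsPair-[] [ b ] R (lose 2j∈B (j , refl , partner∈S′))

  b∈B : b ∈ B
  b∈B with M , B≡ ← grown-extends [ b ] R = subst (b ∈_) (sym B≡) (here refl)

  a∈A : a ∈ A
  a∈A with M , KA≡ ← grown-extends [ a ] L = reverse⁺ (subst (a ∈_) (sym KA≡) (here refl))

  A-ends-with-a : ∀ {c} → c ∈ A → c ≢ a → Precedes A c a
  A-ends-with-a {c} c∈A c≢a with M , KA≡ ← grown-extends [ a ] L with reverse⁻ c∈A
  ... | c∈KA with subst (c ∈_) KA≡ c∈KA
  ...   | here c≡a = ⊥-elim (c≢a c≡a)
  ...   | there c∈M = subst (λ l → Precedes (reverse l) c a) (sym KA≡) (Precedes-reverse⁺ (first c∈M))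

  private
    B++S′-split : ∀ xs {u y ys M₀} → B ≡ xs ++ u ∷ y ∷ ys → xs ++ [ u ] ≡ [ b ] ++ M₀ →
                  [ b ] ++ R ≡ ([ b ] ++ M₀) ++ y ∷ ys ++ S′
    B++S′-split xs {u} {y} {ys} {M₀} B≡ K₀≡ = begin
      [ b ] ++ R                      ≡⟨ grown++rest [ b ] R ⟨
      B ++ S′                         ≡⟨ cong (_++ S′) B≡ ⟩
      (xs ++ u ∷ y ∷ ys) ++ S′        ≡⟨ ++-assoc xs (u ∷ y ∷ ys) S′ ⟩
      xs ++ u ∷ y ∷ ys ++ S′          ≡⟨ ++-assoc xs [ u ] (y ∷ ys ++ S′) ⟨
      (xs ++ [ u ]) ++ y ∷ ys ++ S′   ≡⟨ cong (_++ y ∷ ys ++ S′) K₀≡ ⟩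
      ([ b ] ++ M₀) ++ y ∷ ys ++ S′   ∎
      where open ≡-Reasoning

  B-minimal : ∀ xs {u rest i} → B ≡ xs ++ u ∷ rest → i ∈ rest → ¬ ¬ SplitsPair (xs ++ [ u ]) (rest ++ S′)
  B-minimal xs {rest = []} _ ()
  B-minimal xs {rest = _ ∷ _} B≡ _ closed
    with M₀ , K₀≡ ← prefix-to-head xs (trans (sym B≡) (proj₂ (grown-extends [ b ] R)))
    with M′ , K₀≡B++M′ ← grown-minimal [ b ] R M₀ (B++S′-split xs B≡ K₀≡)
                           (closed ∘ subst (λ K₀ → SplitsPair K₀ _) (sym K₀≡))
    = proper-prefix xs (trans (trans K₀≡ K₀≡B++M′) (cong (_++ M′) B≡))

  private
    after-in-B : ∀ xs {u rest i} → B ≡ xs ++ u ∷ rest → i ∈ B → Precedes σ u i → i ∈ rest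
    after-in-B xs B≡ i∈B u-i with ∈-++⁻ xs (subst (_ ∈_) B≡ i∈B)
    ... | inj₁ i∈xs = ⊥-elim (Precedes-asym uσ u-i (within-B (lift (sym B≡) (Precedes-++⁺ i∈xs (here refl)))))
    ... | inj₂ (here refl) = ⊥-elim (Precedes-irrefl uσ u-i refl)
    ... | inj₂ (there i∈rest) = i∈rest

    after-u : ∀ xs {u rest v} → B ≡ xs ++ u ∷ rest → v ∈ rest ++ S′ → Precedes σ u v
    after-u xs {rest = rest} B≡ v∈ with ∈-++⁻ rest v∈
    ... | inj₁ v∈rest = within-B (lift (sym B≡) (Precedes-++⁺ʳ xs (first v∈rest)))
    ... | inj₂ v∈S′ = B-before-S′ (subst (_ ∈_) (sym B≡) (∈-insert xs)) v∈S′

    no-nested-partner : ∀ {j j′} → 2 * j ∈ A → 2 * j′ ∈ B →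
                        Precedes σ (2 * j′) (2 * j ∸ 1) → ¬ Precedes σ (2 * j ∸ 1) (2 * j′ ∸ 1)
    no-nested-partner {j} {j′} 2j∈A 2j′∈B p q = avoids₂ j′ (2 * j ∸ 1) p q (j′<j⇒2j′<2j∸1 j′<j)
      where
      2j-2j′ : Precedes σ (2 * j) (2 * j′)
      2j-2j′ = A-before-B 2j∈A 2j′∈B
      j′<j : j′ < j
      j′<j = *-cancelˡ-< 2 j′ j (≤∧≢⇒< (≮⇒≥ (avoids₂ j (2 * j′) 2j-2j′ p)) (Precedes-irrefl uσ 2j-2j′ ∘ sym))

    prefix-through-partner-closed : ∀ {j} xs {rest} → 2 * j ∈ A → B ≡ xs ++ (2 * j ∸ 1) ∷ rest →
                                    ¬ SplitsPair (xs ++ [ 2 * j ∸ 1 ]) (rest ++ S′)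
    prefix-through-partner-closed {j} xs 2j∈A B≡ o with find o
    ... | _ , 2j′∈ , j′ , refl , partner∈ with ∈-++⁻ xs 2j′∈
    ...   | inj₂ (here 2j′≡u) =
      2j′≢2j∸1 j′ j (1≤2j∸1⇒1≤j (1≤ (B⊆σ (subst (_ ∈_) (sym B≡) (∈-insert xs))))) 2j′≡u
    ...   | inj₁ 2j′∈xs = no-nested-partner {j} {j′} 2j∈A (subst (_ ∈_) (sym B≡) (∈-++⁺ˡ 2j′∈xs))
                            (within-B (lift (sym B≡) (Precedes-++⁺ 2j′∈xs (here refl)))) (after-u xs B≡ partner∈)

  B-partner-last : ∀ {j i} → 2 * j ∈ A → 2 * j ∸ 1 ∈ B → i ∈ B → ¬ Precedes σ (2 * j ∸ 1) i
  B-partner-last {j} 2j∈A u∈B i∈B u-i with xs , rest , B≡ ← ∈-∃++ u∈B =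
    B-minimal xs B≡ (after-in-B xs B≡ i∈B u-i) (prefix-through-partner-closed {j} xs 2j∈A B≡)

  τ-avoids₁ : Avoids₁ τ
  τ-avoids₁ j i u-i i-v i<u with τ⇒σ u-i
  ... | inj₂ (u∈B , i∈A) = <-asym i<u (B<A i∈A u∈B)
  ... | inj₁ σ-u-i with τ⇒σ i-v
  ...   | inj₁ σ-i-v = avoids₁ j i σ-u-i σ-i-v i<u
  ...   | inj₂ (i∈B , v∈A) with block (Precedes⇒∈ˡ σ-u-i)
  ...     | inj₁ u∈P′ = A-closed {j} v∈A u∈P′
  ...     | inj₂ (inj₁ u∈A) = Precedes-asym τ-unique u-i (B-before-A-in-τ i∈B u∈A)
  ...     | inj₂ (inj₂ (inj₁ u∈B)) = B-partner-last {j} v∈A u∈B i∈B σ-u-i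
  ...     | inj₂ (inj₂ (inj₂ u∈S′)) = Precedes-asym uσ σ-u-i (B-before-S′ i∈B u∈S′)

  τ-avoids₂ : Avoids₂ τ
  τ-avoids₂ j k v-k k-u 2j<k with τ⇒σ v-k | τ⇒σ k-u
  ... | inj₁ σ-v-k | inj₁ σ-k-u = avoids₂ j k σ-v-k σ-k-u 2j<k
  ... | inj₁ _ | inj₂ (k∈B , u∈A) = <-asym (B<A u∈A k∈B) (≤-<-trans (m∸n≤m (2 * j) 1) 2j<k)
  ... | inj₂ (_ , k∈A) | inj₂ (k∈B , _) = Precedes-irrefl uσ (A-before-B k∈A k∈B) refl
  ... | inj₂ (v∈B , k∈A) | inj₁ σ-k-u with block (Precedes⇒∈ʳ σ-k-u)
  ...   | inj₁ u∈P′ = Precedes-asym uσ σ-k-u (P′-before-A u∈P′ k∈A)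
  ...   | inj₂ (inj₁ u∈A) = <⇒≱ (B<A u∈A v∈B) (m∸n≤m (2 * j) 1)
  ...   | inj₂ (inj₂ (inj₁ u∈B)) = Precedes-asym τ-unique k-u (B-before-A-in-τ u∈B k∈A)
  ...   | inj₂ (inj₂ (inj₂ u∈S′)) = B-closed {j} v∈B u∈S′

  τ-wiggly : Wiggly n τ
  τ-wiggly = Avoids⇒Wiggly τ-perm τ-avoids₁ τ-avoids₂

  τ⊑σ : τ ⊑ σ
  τ⊑σ p y<x with τ⇒σ p
  ... | inj₁ q = q
  ... | inj₂ (x∈B , y∈A) = ⊥-elim (<-asym y<x (B<A y∈A x∈B))

  τ-uninverts : ¬ Precedes τ a b
  τ-uninverts a-b = Precedes-asym τ-unique a-b (B-before-A-in-τ b∈B a∈A)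

  τ-keeps : ∀ (d : Descent σ) → top d ≢ a → Precedes τ (top d) (bottom d)
  τ-keeps d top≢a with σ⇒τ (Descent-Precedes d)
  ... | inj₁ kept = kept
  ... | inj₂ (top∈A , bottom∈B) = ⊥-elim (adjacent-nothing-between (prefix d) (subst Unique (split d) uσ)
          (lift (split d) (within-A (A-ends-with-a top∈A top≢a)))
          (lift (split d) (A-before-B a∈A bottom∈B)))

  τ-fewer-inversions : inversions τ < inversions σ
  τ-fewer-inversions = begin-strict
    inversions τ                         <⟨ m<m+n _ (crossings-pos A B a∈A b∈B b<a) ⟩
    inversions τ + crossings A B         ≡⟨ inversions-swap P′ A B S′ ⟩
    inversions σ′ + crossings B A        ≡⟨ cong₂ _+_ (cong inversions (sym σ-blocks)) B-A-no-crossings ⟩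
    inversions σ + 0                     ≡⟨ +-identityʳ _ ⟩
    inversions σ                         ∎
    where
    open ≤-Reasoning
    B-A-no-crossings : crossings B A ≡ 0
    B-A-no-crossings = crossings-none B A (All.tabulate λ y∈B → All.tabulate λ x∈A → B<A x∈A y∈B)

  module _ {ρ : List ℕ} (ρ-wiggly : Wiggly n ρ) (ρ⊑σ : ρ ⊑ σ) (ρ-uninverts : ¬ Precedes ρ a b) where

    private
      uρ : Unique ρ
      uρ = Wiggly⇒Unique ρ-wiggly

      inρ : ∀ {u} → u ∈ σ → u ∈ ρ
      inρ = Perm-∈ (proj₁ σ-wiggly) (proj₁ ρ-wiggly)

      ρ-order : ∀ {u v} → u ∈ σ → v ∈ σ → u ≢ v → ¬ Precedes ρ v u → Precedes ρ u v
      ρ-order u∈ v∈ u≢v = Precedes-flip uρ (inρ v∈) (inρ u∈) (u≢v ∘ sym)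

      ρ-keeps-ascent : ∀ {u v} → Precedes σ u v → u < v → Precedes ρ u v
      ρ-keeps-ascent = ⊑-keeps-ascent (proj₁ σ-wiggly) (proj₁ ρ-wiggly) ρ⊑σ

      ρ-partner-before-a : ∀ {j} → 2 * j < a → Precedes ρ (2 * j) a → 2 * j ∸ 1 ∈ σ → Precedes ρ (2 * j ∸ 1) a
      ρ-partner-before-a {j} 2j<a 2j-a u∈σ = ρ-order u∈σ a∈σ (<⇒≢ (≤-<-trans (m∸n≤m (2 * j) 1) 2j<a))
        (λ a-u → Wiggly⇒Avoids₂ ρ-wiggly j a 2j-a a-u 2j<a)

      ρ-absorbed-B : ∀ {j h} → 2 * j < a → Precedes ρ (2 * j) a → Precedes σ (2 * j) h →
                     h ≡ 2 * j ∸ 1 ⊎ Precedes σ h (2 * j ∸ 1) → Precedes ρ h a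
      ρ-absorbed-B {j} 2j<a 2j-a p (inj₁ refl) = ρ-partner-before-a {j} 2j<a 2j-a (Precedes⇒∈ʳ p)
      ρ-absorbed-B {j} 2j<a 2j-a p (inj₂ q) =
        Precedes-trans uρ (ρ-keeps-ascent q h<u) (ρ-partner-before-a {j} 2j<a 2j-a (Precedes⇒∈ʳ q))
        where
        h<u = ≤∧≢⇒< (<⇒≤pred (absorbed-below {j} p (inj₂ q))) (Precedes-irrefl uσ q)

      ρ-below-partner : ∀ {j y} → y ∈ B → y < 2 * j → Precedes ρ y (2 * j) → 2 * j ∸ 1 ∈ a ∷ L →
                        Precedes ρ y (2 * j ∸ 1)
      ρ-below-partner {j} {y} y∈B y<2j y-2j partner∈ =
        ρ-order (B⊆σ y∈B) (Precedes⇒∈ˡ u-b) y≢u (λ u-y → Wiggly⇒Avoids₁ ρ-wiggly j y u-y y-2j y<u)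
        where
        u-b = left-before-right partner∈ (here refl)
        y≢u = Precedes-irrefl uσ (left-before-right partner∈ (B⊆right y∈B)) ∘ sym
        y<u = ≤∧≢⇒< (<⇒≤pred y<2j) y≢u

      ρ-absorbed-A : ∀ {j h y} → y ∈ B → y < 2 * j → Precedes ρ y (2 * j) → 2 * j ∸ 1 ∈ a ∷ L →
                     Precedes σ h (2 * j) → h ≡ 2 * j ∸ 1 ⊎ Precedes σ (2 * j ∸ 1) h → Precedes ρ y h
      ρ-absorbed-A {j} y∈B y<2j y-2j partner∈ _ (inj₁ refl) = ρ-below-partner {j} y∈B y<2j y-2j partner∈
      ρ-absorbed-A {j} y∈B y<2j y-2j partner∈ p (inj₂ q) =
        Precedes-trans uρ (ρ-below-partner {j} y∈B y<2j y-2j partner∈)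
          (ρ-keeps-ascent q (≤-<-trans (m∸n≤m (2 * j) 1) (absorbed-above {j} p q)))

    ρ-B-before-a : All (λ y → y < a × Precedes ρ y a) B
    ρ-B-before-a = grown-preserves _ [ b ] R step ((b<a , b-a) ∷ [])
      where
      b-a = ρ-order (Precedes⇒∈ʳ ab) a∈σ (<⇒≢ b<a) ρ-uninverts
      step : ∀ {K h R′} → K ++ h ∷ R′ ≡ [ b ] ++ R → SplitsPair K (h ∷ R′) →
             All (λ y → y < a × Precedes ρ y a) K → h < a × Precedes ρ h a
      step eq o K-below with j , 2j∈K , p , partner ← B-step eq o with 2j<a , 2j-a ← All.lookup K-below 2j∈K =
        <-trans (absorbed-below {j} p partner) 2j<a , ρ-absorbed-B {j} 2j<a 2j-a p partner

    ρ-B-before-KA : All (λ x → All (λ y → y < x × Precedes ρ y x) B) KA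
    ρ-B-before-KA = grown-preserves _ [ a ] L step (ρ-B-before-a ∷ [])
      where
      step : ∀ {K h L′} → K ++ h ∷ L′ ≡ [ a ] ++ L → SplitsPair K (h ∷ L′) →
             All (λ x → All (λ y → y < x × Precedes ρ y x) B) K → All (λ y → y < h × Precedes ρ y h) B
      step eq o K-above with j , 2j∈K , p , partner∈ , partner ← A-step eq o =
        All.tabulate λ y∈B → let y<2j , y-2j = All.lookup (All.lookup K-above 2j∈K) y∈B in
          All.lookup (above-B {j} (All.map proj₁ (All.lookup K-above 2j∈K)) partner∈ p partner) y∈B ,
          ρ-absorbed-A {j} y∈B y<2j y-2j partner∈ p partner

    ρ⊑τ : ρ ⊑ τ
    ρ⊑τ p y<x with σ⇒τ (ρ⊑σ p y<x)
    ... | inj₁ q = q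
    ... | inj₂ (x∈A , y∈B) =
      ⊥-elim (Precedes-asym uρ p (proj₂ (All.lookup (All.lookup ρ-B-before-KA (reverse⁻ x∈A)) y∈B)))

HasCard-involution : ∀ {P Q : List ℕ → Set} {k} (f : List ℕ → List ℕ) →
                     (∀ {τ} → P τ → Q (f τ)) → (∀ {τ} → Q τ → P (f τ)) →
                     (∀ {τ} → P τ ⊎ Q τ → f (f τ) ≡ τ) → HasCard P k → HasCard Q k
HasCard-involution {P} {Q} f P⇒Q Q⇒P involutive (L , uL , L⇔P , |L|≡k) =
  map f L , map⁺-injectiveOn injective uL , (λ τ → mk⇔ (from-list τ) (to-list τ)) ,
  trans (length-map f L) |L|≡k
  where
  P-on-L : ∀ {τ} → τ ∈ L → P τ
  P-on-L = Equivalence.to (L⇔P _)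
  injective : ∀ {x y} → x ∈ L → y ∈ L → f x ≡ f y → x ≡ y
  injective x∈ y∈ eq =
    trans (sym (involutive (inj₁ (P-on-L x∈)))) (trans (cong f eq) (involutive (inj₁ (P-on-L y∈))))
  from-list : ∀ τ → τ ∈ map f L → Q τ
  from-list τ τ∈ with τ′ , τ′∈ , refl ← ∈-map⁻ f τ∈ = P⇒Q (P-on-L τ′∈)
  to-list : ∀ τ → Q τ → τ ∈ map f L
  to-list τ q = subst (_∈ map f L) (involutive (inj₂ q)) (∈-map⁺ f (Equivalence.from (L⇔P _) (Q⇒P q)))

HasCard-⊎ : ∀ {P Q : List ℕ → Set} {k l} → HasCard P k → HasCard Q l → (∀ {τ} → P τ → ¬ Q τ) →
            HasCard (λ τ → P τ ⊎ Q τ) (k + l)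
HasCard-⊎ (L₁ , u₁ , L₁⇔P , |L₁|≡k) (L₂ , u₂ , L₂⇔Q , |L₂|≡l) disjoint =
  L₁ ++ L₂ ,
  Unique.++⁺ u₁ u₂ (λ (∈₁ , ∈₂) → disjoint (Equivalence.to (L₁⇔P _) ∈₁) (Equivalence.to (L₂⇔Q _) ∈₂)) ,
  (λ τ → mk⇔ (Sum.map (Equivalence.to (L₁⇔P τ)) (Equivalence.to (L₂⇔Q τ)) ∘ ∈-++⁻ L₁)
             Sum.[ ∈-++⁺ˡ ∘ Equivalence.from (L₁⇔P τ) , ∈-++⁺ʳ L₁ ∘ Equivalence.from (L₂⇔Q τ) ]) ,
  trans (length-++ L₁) (cong₂ _+_ |L₁|≡k |L₂|≡l)

Descent-top⇒bottom : ∀ {σ} → Unique σ → (d d′ : Descent σ) → top d ≡ top d′ → bottom d ≡ bottom d′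
Descent-top⇒bottom u (descent p _ _ _ refl _) (descent p′ _ _ _ eq _) refl = adjacent-successor-unique p p′ u eq

reverse-prefix : ∀ (p : List ℕ) a r → p ++ a ∷ r ≡ reverse (a ∷ reverse p) ++ r
reverse-prefix p a r = begin
  p ++ a ∷ r                          ≡⟨ ++-assoc p [ a ] r ⟨
  (p ++ [ a ]) ++ r                   ≡⟨ cong (λ q → (q ++ [ a ]) ++ r) (reverse-involutive p) ⟨
  (reverse (reverse p) ++ [ a ]) ++ r  ≡⟨ cong (_++ r) (unfold-reverse a (reverse p)) ⟨
  reverse (a ∷ reverse p) ++ r        ∎
  where open ≡-Reasoning

module _ {n : ℕ} {σ : List ℕ} (σ-wiggly : Wiggly n σ) where

  private
    uσ : Unique σ
    uσ = Wiggly⇒Unique σ-wiggly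

    module Cov (d : Descent σ) = Cover σ-wiggly (reverse (prefix d)) (top d) (bottom d) (suffix d)
                                     (trans (split d) (reverse-prefix (prefix d) (top d) _)) (bottom<top d)

  cover : Descent σ → List ℕ
  cover = Cov.τ

  cover-wiggly : (d : Descent σ) → Wiggly n (cover d)
  cover-wiggly = Cov.τ-wiggly

  cover-fewer-inversions : (d : Descent σ) → inversions (cover d) < inversions σ
  cover-fewer-inversions = Cov.τ-fewer-inversions

  cover<W : (d : Descent σ) → cover d <W σ
  cover<W d = ⊑⇒≤W (Cov.τ⊑σ d) ,
    λ eq → Cov.τ-uninverts d (subst (λ l → Precedes l _ _) (sym eq) (Descent-Precedes d))

  cover-covered : (d : Descent σ) → Covers n σ (cover d)
  cover-covered d = σ-wiggly , Cov.τ-wiggly d , cover<W d , nothing-between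
    where
    nothing-between : ¬ (∃[ ρ ] (Wiggly n ρ × cover d <W ρ × ρ <W σ))
    nothing-between (ρ , ρ-wiggly , (τ≤ρ , τ≢ρ) , ρ<σ)
      with d′ , lost ← <W⇒UninvertedDescent (proj₁ σ-wiggly) (proj₁ ρ-wiggly) ρ<σ
      with top d′ ≟ top d
    ... | no top≢ = lost (≤W⇒⊑ τ≤ρ (Cov.τ-keeps d d′ top≢) (bottom<top d′))
    ... | yes top≡ = τ≢ρ (⊑-antisym (proj₁ ρ-wiggly) (Cov.τ-perm d) (≤W⇒⊑ τ≤ρ)
                       (Cov.ρ⊑τ d ρ-wiggly (≤W⇒⊑ (proj₁ ρ<σ))
                         (subst₂ (λ x y → ¬ Precedes ρ x y) top≡ (Descent-top⇒bottom uσ d′ d top≡) lost)))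

  covered⇒cover : ∀ {τ} → Covers n σ τ → ∃[ d ] (d ∈ descentList σ × τ ≡ cover d)
  covered⇒cover {τ} (_ , τ-wiggly , τ<σ , nothing-between)
    with d₀ , lost ← <W⇒UninvertedDescent (proj₁ σ-wiggly) (proj₁ τ-wiggly) τ<σ
    with d , d∈ , refl , refl ← descentList-complete d₀
    with ≡-dec _≟_ τ (cover d)
  ... | yes τ≡ = d , d∈ , τ≡
  ... | no τ≢ = ⊥-elim (nothing-between (cover d , Cov.τ-wiggly d ,
                  (⊑⇒≤W (Cov.ρ⊑τ d τ-wiggly (≤W⇒⊑ (proj₁ τ<σ)) lost) , τ≢) , cover<W d))

  cover-injective : ∀ (d d′ : Descent σ) → top d ≢ top d′ → cover d ≢ cover d′
  cover-injective d d′ top≢ eq =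
    Cov.τ-uninverts d′ (subst (λ l → Precedes l _ _) eq (Cov.τ-keeps d d′ (top≢ ∘ sym)))

  lower-covers : HasCard (λ τ → Covers n σ τ) (descents σ)
  lower-covers = map cover (descentList σ) ,
    AllPairs.map⁺ (AllPairs.map (λ {d} {d′} → cover-injective d d′) (descentList-tops-distinct uσ)) ,
    (λ τ → mk⇔ (from-list τ) (to-list τ)) ,
    trans (length-map cover (descentList σ)) (length-descentList σ)
    where
    from-list : ∀ τ → τ ∈ map cover (descentList σ) → Covers n σ τ
    from-list τ τ∈ with d , _ , refl ← ∈-map⁻ cover τ∈ = cover-covered d
    to-list : ∀ τ → Covers n σ τ → τ ∈ map cover (descentList σ)
    to-list τ σ⋗τ with d , d∈ , refl ← covered⇒cover σ⋗τ = ∈-map⁺ cover d∈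

-- Upper covers, by complementation

applyUpTo-∸ : ∀ m → applyUpTo (m ∸_) m ≡ reverse (applyUpTo suc m)
applyUpTo-∸ zero = refl
applyUpTo-∸ (suc m) = begin
  suc m ∷ applyUpTo (m ∸_) m                ≡⟨ cong (suc m ∷_) (applyUpTo-∸ m) ⟩
  suc m ∷ reverse (applyUpTo suc m)         ≡⟨ reverse-++ (applyUpTo suc m) [ suc m ] ⟨
  reverse (applyUpTo suc m ++ [ suc m ])    ≡⟨ cong reverse (applyUpTo-∷ʳ suc m) ⟩
  reverse (applyUpTo suc (suc m))           ∎
  where open ≡-Reasoning

module Complement (n : ℕ) where

  c : ℕ → ℕ
  c x = suc (2 * n) ∸ x

  complement : List ℕ → List ℕ
  complement = map c

  c-involutive : ∀ {x} → x ≤ suc (2 * n) → c (c x) ≡ x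
  c-involutive = m∸[m∸n]≡n

  c-reverses-< : ∀ {x y} → y ≤ suc (2 * n) → (c y <ᵇ c x) ≡ (x <ᵇ y)
  c-reverses-< {x} {y} y≤ with c y <ᵇ c x | <ᵇ-reflects-< (c y) (c x) | x <ᵇ y | <ᵇ-reflects-< x y
  ... | true | _ | true | _ = refl
  ... | false | _ | false | _ = refl
  ... | true | ofʸ cy<cx | false | ofⁿ x≮y = ⊥-elim (x≮y (∸-cancelʳ-< cy<cx))
  ... | false | ofⁿ cy≮cx | true | ofʸ x<y = ⊥-elim (cy≮cx (∸-monoʳ-< x<y y≤))

  c-odd : ∀ k → c (2 * suc k ∸ 1) ≡ 2 * (n ∸ k)
  c-odd k = begin
    suc (2 * n) ∸ (2 * suc k ∸ 1)  ≡⟨ cong (λ t → suc (2 * n) ∸ (t ∸ 1)) (*-suc 2 k) ⟩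
    2 * n ∸ 2 * k                  ≡⟨ *-distribˡ-∸ 2 n k ⟨
    2 * (n ∸ k)                    ∎
    where open ≡-Reasoning

  c-even : ∀ k → c (2 * suc k) ≡ 2 * (n ∸ k) ∸ 1
  c-even k = begin
    suc (2 * n) ∸ 2 * suc k        ≡⟨ cong (suc (2 * n) ∸_) (*-suc 2 k) ⟩
    2 * n ∸ (1 + 2 * k)            ≡⟨ cong (2 * n ∸_) (+-comm 1 (2 * k)) ⟩
    2 * n ∸ (2 * k + 1)            ≡⟨ ∸-+-assoc (2 * n) (2 * k) 1 ⟨
    2 * n ∸ 2 * k ∸ 1              ≡⟨ cong (_∸ 1) (*-distribˡ-∸ 2 n k) ⟨
    2 * (n ∸ k) ∸ 1                ∎
    where open ≡-Reasoning

  module _ {σ : List ℕ} (σ-perm : Perm (2 * n) σ) where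

    ≤1+2n : ∀ {x} → x ∈ σ → x ≤ suc (2 * n)
    ≤1+2n x∈σ = m≤n⇒m≤1+n (proj₂ (Perm-∈⇒bounds σ-perm x∈σ))

    c-injectiveOn : ∀ {x y} → x ∈ σ → y ∈ σ → c x ≡ c y → x ≡ y
    c-injectiveOn x∈ y∈ eq = trans (sym (c-involutive (≤1+2n x∈))) (trans (cong c eq) (c-involutive (≤1+2n y∈)))

    complement-involutive : complement (complement σ) ≡ σ
    complement-involutive = trans (sym (map-∘ σ)) (map-id-local (All.tabulate (c-involutive ∘ ≤1+2n)))

    complement-perm : Perm (2 * n) (complement σ)
    complement-perm = ↭-trans (map⁺ c σ-perm)
      (↭-trans (↭-reflexive (trans (map-applyUpTo suc c (2 * n)) (applyUpTo-∸ (2 * n))))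
               (↭-reverse (applyUpTo suc (2 * n))))

    complement-pair : ∀ {j x y} → x ∈ σ → y ∈ σ → c x ≡ 2 * j ∸ 1 → c y ≡ 2 * j →
                      ∃[ j′ ] (x ≡ 2 * j′ × y ≡ 2 * j′ ∸ 1)
    complement-pair {zero} x∈ _ cx≡0 _ =
      ⊥-elim (<⇒≢ (m<n⇒0<n∸m (s≤s (proj₂ (Perm-∈⇒bounds σ-perm x∈)))) (sym cx≡0))
    complement-pair {suc k} x∈ y∈ cx≡ cy≡ = n ∸ k ,
      trans (sym (c-involutive (≤1+2n x∈))) (trans (cong c cx≡) (c-odd k)) ,
      trans (sym (c-involutive (≤1+2n y∈))) (trans (cong c cy≡) (c-even k))

    complement-avoids₁ : Avoids₂ σ → Avoids₁ (complement σ)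
    complement-avoids₁ avoids₂ j i p q i<u
      with u , w , cu≡ , refl , σ-u-w ← Precedes-map⁻ σ p
      with w′ , v , cw′≡ , cv≡ , σ-w′-v ← Precedes-map⁻ σ q
      with refl ← c-injectiveOn (Precedes⇒∈ˡ σ-w′-v) (Precedes⇒∈ʳ σ-u-w) cw′≡
      with j′ , refl , refl ← complement-pair {j} (Precedes⇒∈ˡ σ-u-w) (Precedes⇒∈ʳ σ-w′-v) cu≡ cv≡
      = avoids₂ j′ w σ-u-w σ-w′-v (∸-cancelʳ-< (subst (c w <_) (sym cu≡) i<u))

    complement-avoids₂ : Avoids₁ σ → Avoids₂ (complement σ)
    complement-avoids₂ avoids₁ j k p q 2j<k
      with v , w , cv≡ , refl , σ-v-w ← Precedes-map⁻ σ p
      with w′ , u , cw′≡ , cu≡ , σ-w′-u ← Precedes-map⁻ σ q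
      with refl ← c-injectiveOn (Precedes⇒∈ˡ σ-w′-u) (Precedes⇒∈ʳ σ-v-w) cw′≡
      with j′ , refl , refl ← complement-pair {j} (Precedes⇒∈ʳ σ-w′-u) (Precedes⇒∈ˡ σ-v-w) cu≡ cv≡
      = avoids₁ j′ w σ-v-w σ-w′-u (∸-cancelʳ-< (subst (_< c w) (sym cv≡) 2j<k))

  complement-wiggly : ∀ {σ} → Wiggly n σ → Wiggly n (complement σ)
  complement-wiggly σ-wiggly@(σ-perm , _) = Avoids⇒Wiggly (complement-perm σ-perm)
    (complement-avoids₁ σ-perm (Wiggly⇒Avoids₂ σ-wiggly)) (complement-avoids₂ σ-perm (Wiggly⇒Avoids₁ σ-wiggly))

  complement-⊑ : ∀ {σ τ} → Perm (2 * n) σ → Perm (2 * n) τ → τ ⊑ σ → complement σ ⊑ complement τ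
  complement-⊑ {σ} pσ pτ τ⊑σ p cv<cu with u , v , refl , refl , σ-u-v ← Precedes-map⁻ σ p =
    Precedes-map⁺ c (⊑-keeps-ascent pσ pτ τ⊑σ σ-u-v (∸-cancelʳ-< cv<cu))

  complement-<W : ∀ {σ τ} → Perm (2 * n) σ → Perm (2 * n) τ → τ <W σ → complement σ <W complement τ
  complement-<W {σ} {τ} pσ pτ (τ≤σ , τ≢σ) = ⊑⇒≤W (complement-⊑ pσ pτ (≤W⇒⊑ τ≤σ)) ,
    λ eq → τ≢σ (begin
      τ                           ≡⟨ complement-involutive pτ ⟨
      complement (complement τ)   ≡⟨ cong complement eq ⟨
      complement (complement σ)   ≡⟨ complement-involutive pσ ⟩
      σ                           ∎)
    where open ≡-Reasoning

  complement-covers : ∀ {σ τ} → Covers n σ τ → Covers n (complement τ) (complement σ)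
  complement-covers (σ-wiggly , τ-wiggly , τ<σ , nothing-between) =
    complement-wiggly τ-wiggly , complement-wiggly σ-wiggly ,
    complement-<W (proj₁ σ-wiggly) (proj₁ τ-wiggly) τ<σ ,
    λ (ρ , ρ-wiggly , cσ<ρ , ρ<cτ) → nothing-between (complement ρ , complement-wiggly ρ-wiggly ,
      subst (_<W complement ρ) (complement-involutive (proj₁ τ-wiggly))
        (complement-<W (complement-perm (proj₁ τ-wiggly)) (proj₁ ρ-wiggly) ρ<cτ) ,
      subst (complement ρ <W_) (complement-involutive (proj₁ σ-wiggly))
        (complement-<W (proj₁ ρ-wiggly) (complement-perm (proj₁ σ-wiggly)) cσ<ρ))

  descents-complement : ∀ σ → All (_≤ suc (2 * n)) σ → descents (complement σ) ≡ ascents σ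
  descents-complement [] _ = refl
  descents-complement (_ ∷ []) _ = refl
  descents-complement (x ∷ y ∷ σ) (_ ∷ y≤ ∷ σ≤) =
    cong₂ (λ b d → (if b then 1 else 0) + d) (c-reverses-< y≤) (descents-complement (y ∷ σ) (y≤ ∷ σ≤))

  upper-covers : ∀ {σ} → Wiggly n σ → HasCard (λ τ → Covers n τ σ) (ascents σ)
  upper-covers {σ} σ-wiggly@(σ-perm , _) = HasCard-involution complement
    (λ cσ⋗τ → subst (Covers n (complement _)) (complement-involutive σ-perm) (complement-covers cσ⋗τ))
    complement-covers
    (λ { (inj₁ (_ , (τ-perm , _) , _)) → complement-involutive τ-perm
       ; (inj₂ ((τ-perm , _) , _)) → complement-involutive τ-perm })
    (subst (HasCard _) (descents-complement σ (All.tabulate (≤1+2n σ-perm)))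
      (lower-covers (complement-wiggly σ-wiggly)))

descent+ascent≡1 : ∀ {x y} → x ≢ y → (if y <ᵇ x then 1 else 0) + (if x <ᵇ y then 1 else 0) ≡ 1
descent+ascent≡1 {x} {y} x≢y with y <ᵇ x | <ᵇ-reflects-< y x | x <ᵇ y | <ᵇ-reflects-< x y
... | true | ofʸ y<x | true | ofʸ x<y = ⊥-elim (<-asym y<x x<y)
... | true | _ | false | _ = refl
... | false | _ | true | _ = refl
... | false | ofⁿ y≮x | false | ofⁿ x≮y = ⊥-elim (x≢y (≤-antisym (≮⇒≥ y≮x) (≮⇒≥ x≮y)))

descents+ascents : ∀ σ → Unique σ → descents σ + ascents σ ≡ length σ ∸ 1
descents+ascents [] _ = refl
descents+ascents (_ ∷ []) _ = refl
descents+ascents (x ∷ y ∷ σ) ((x≢y ∷ _) ∷ u) = begin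
  (d + descents (y ∷ σ)) + (a + ascents (y ∷ σ))  ≡⟨ +-interchange d _ a _ ⟩
  (d + a) + (descents (y ∷ σ) + ascents (y ∷ σ))  ≡⟨ cong₂ _+_ (descent+ascent≡1 x≢y)
                                                                (descents+ascents (y ∷ σ) u) ⟩
  1 + (length (y ∷ σ) ∸ 1)                        ∎
  where
  open ≡-Reasoning
  d = if y <ᵇ x then 1 else 0
  a = if x <ᵇ y then 1 else 0
  +-interchange : ∀ p q r s → (p + q) + (r + s) ≡ (p + r) + (q + s)
  +-interchange = solve-∀

module _ {n : ℕ} where

  covers-asym : ∀ {σ τ} → Covers n σ τ → ¬ Covers n τ σ
  covers-asym (σ-wiggly , τ-wiggly , (τ≤σ , τ≢σ) , _) (_ , _ , (σ≤τ , _) , _) =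
    τ≢σ (⊑-antisym (proj₁ σ-wiggly) (proj₁ τ-wiggly) (≤W⇒⊑ τ≤σ) (≤W⇒⊑ σ≤τ))

  neighbours : ∀ {σ} → Wiggly n σ → HasCard (Adj n σ) (2 * n ∸ 1)
  neighbours {σ} σ-wiggly@(σ-perm , _) =
    subst (HasCard (Adj n σ)) degree
      (HasCard-⊎ (lower-covers σ-wiggly) (Complement.upper-covers n σ-wiggly) covers-asym)
    where
    open ≡-Reasoning
    degree : descents σ + ascents σ ≡ 2 * n ∸ 1
    degree = begin
      descents σ + ascents σ  ≡⟨ descents+ascents σ (Perm⇒Unique σ-perm) ⟩
      length σ ∸ 1            ≡⟨ cong (_∸ 1) (trans (↭-length σ-perm) (length-applyUpTo suc (2 * n))) ⟩
      2 * n ∸ 1               ∎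

  ι : List ℕ
  ι = applyUpTo suc (2 * n)

  ι-least : ∀ {σ} → ι ⊑ σ
  ι-least p y<x = ⊥-elim (<-asym y<x (AllPairs-Precedes ι-increasing p))
    where
    ι-increasing : AllPairs _<_ ι
    ι-increasing = AllPairs.applyUpTo⁺₁ suc (2 * n) (λ i<j _ → s≤s i<j)

  path-to-ι : ∀ {σ} → Wiggly n σ → Acc _<_ (inversions σ) → Star (Adj n) σ ι
  path-to-ι σ-wiggly (acc smaller) with ⊑⇒≡⊎UninvertedDescent (proj₁ σ-wiggly) ↭-refl ι-least
  ... | inj₁ ι≡σ = subst (λ τ → Star (Adj n) τ ι) ι≡σ ε
  ... | inj₂ (d , _) = inj₁ (cover-covered σ-wiggly d) ◅
                        path-to-ι (cover-wiggly σ-wiggly d) (smaller (cover-fewer-inversions σ-wiggly d))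

  connected : ∀ {σ τ} → Wiggly n σ → Wiggly n τ → Star (Adj n) σ τ
  connected σ-wiggly τ-wiggly =
    path-to-ι σ-wiggly (<-wellFounded _) ◅◅ Star.reverse Sum.swap (path-to-ι τ-wiggly (<-wellFounded _))

proposition2p33 : ∀ (n : ℕ) → 1 ≤ n →
    (∀ σ → Wiggly n σ → HasCard (λ τ → Covers n σ τ) (descents σ))
    × (∀ σ → Wiggly n σ → HasCard (λ τ → Covers n τ σ) (ascents σ))
    × (∀ σ → Wiggly n σ → HasCard (λ τ → Adj n σ τ) (2 * n ∸ 1))
    × (∀ σ τ → Wiggly n σ → Wiggly n τ → Star (Adj n) σ τ)
proposition2p33 n _ =
  (λ _ → lower-covers) , (λ _ → Complement.upper-covers n) , (λ _ → neighbours) , (λ _ _ → connected)
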